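{- For $A\vdash[n]$ and $B\vdash[m]$, in $NCSym^\ast$ $$\mathbf{w}_A\mathbf{w}_B=\sum_{C:\ C^!\in A^!\sqcup\!\sqcup B^!}\mathbf{w}_C\;+\;\sum_{D:\ \ell(D^!)<\ell(A^!)+\ell(B^!)} c_D\,\mathbf{w}_D,$$ where the first sum runs over the multiset $A^!\sqcup\!\sqcup B^!$ (each shuffle word $u$ contributing $\mathbf{w}_C$ for the set partition $C$ with $C^!=u$) and the $c_D$ are nonnegative integers.
   Context: A set partition $A\vdash[n]$ is a set of nonempty pairwise disjoint subsets (parts) of $[n]$ with union $[n]$. For $A\vdash[n]$, $B\vdash[k]$, $A|B\vdash[n+k]$ consists of the parts of $A$ together with the parts of $B$ shifted by $n$. $A$ is atomic if $n\ge1$ and $A\ne B|C$ with $B\vdash[j]$, $C\vdash[n-j]$, $0<j<n$. Each $A$ factors uniquely as $A=A^{(1)}|\cdots|A^{(d)}$ with all $A^{(j)}$ atomic; $A^!=(A^{(1)},\dots,A^{(d)})$ is a word in the alphabet of atomic set partitions, $\ell(A^!)=d$, and $A\mapsto A^!$ is a bijection onto all such words. For words $u,v$, $u\sqcup\!\sqcup v$ is the multiset of all shuffles. For an $n$-element set $S$ of integers, $A\!\uparrow_S$ replaces entries via the order-preserving bijection $[n]\to S$. $NCSym^\ast$ is the commutative $\mathbb{Q}$-algebra with basis $\{\mathbf{w}_A : A\vdash[n], n\ge 0\}$ and product $\mathbf{w}_A\mathbf{w}_B=\sum_{S\in\binom{[n+m]}{n}}\mathbf{w}_{A\uparrow_S\cup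 B\uparrow_{[n+m]\setminus S}}$ for $A\vdash[n]$, $B\vdash[m]$ (this is the graded dual of $NCSym$ with respect to the basis dual to the monomial basis). -}

module Defs where

open import Data.Nat using (ℕ; zero; suc; _+_; _*_; _∸_; _<_; _≤_; _≡ᵇ_)
open import Data.Bool using (Bool; true; false; _∧_; not; _xor_; if_then_else_)
open import Data.List using (List; []; _∷_; _++_; map; length; upTo)
open import Data.List.Relation.Unary.All using (All)
open import Data.Product using (Σ; _×_)
open import Relation.Binary.PropositionalEquality using (_≡_)
open import Relation.Nullary using (¬_)

-- A set partition of [n] is encoded by a labelling  xs : List ℕ  of
-- length n: position i (0-based) stands for the element i+1 of [n], and
-- xs ! i is the name of the block containing it.  Two labellings encode
-- the same set partition iff they have the same length and the same
-- kernel (same pairs of positions in a common block); this is tested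
-- by  _≈ᵇ_  below.

Part : Set
Part = List ℕ

-- block label at position i (default 0 out of range; only used in range)
_!_ : List ℕ → ℕ → ℕ
[]       ! _     = 0
(x ∷ xs) ! zero  = x
(x ∷ xs) ! suc i = xs ! i

allᵇ : {X : Set} → (X → Bool) → List X → Bool
allᵇ p []       = true
allᵇ p (x ∷ xs) = p x ∧ allᵇ p xs

_⇔ᵇ_ : Bool → Bool → Bool
a ⇔ᵇ b = not (a xor b)

_≈ᵇ_ : Part → Part → Bool
xs ≈ᵇ ys =
  (length xs ≡ᵇ length ys) ∧
  allᵇ (λ i → allᵇ (λ j → ((xs ! i) ≡ᵇ (xs ! j)) ⇔ᵇ ((ys ! i) ≡ᵇ (ys ! j)))
                 (upTo (length xs)))
      (upTo (length xs))

-- A | B : parts of A together with parts of B shifted by n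
-- (blocks of A get even labels, blocks of B odd labels, so they stay apart)
_∣_ : Part → Part → Part
A ∣ B = map (λ a → 2 * a) A ++ map (λ b → suc (2 * b)) B

Atomic : Part → Set
Atomic A =
  1 ≤ length A ×
  ¬ (Σ ℕ λ j → Σ Part λ B → Σ Part λ C →
        0 < j × j < length A × length B ≡ j × length C ≡ length A ∸ j ×
        (A ≈ᵇ (B ∣ C)) ≡ true)

concatW : List Part → Part
concatW []      = []
concatW (a ∷ w) = a ∣ concatW w

-- w is the atomic factorisation A^! of A  (unique by the paper's remark)
IsFactorisation : Part → List Part → Set
IsFactorisation A w = All Atomic w × (concatW w ≈ᵇ A) ≡ true

-- Shuffles (as a multiset, i.e. a list with repetitions)

shuffles : {X : Set} → List X → List X → List (List X)
shuffles []           v            = v ∷ []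
shuffles u@(_ ∷ _)    []           = u ∷ []
shuffles (x ∷ u)      (y ∷ v)      =
  map (x ∷_) (shuffles u (y ∷ v)) ++ map (y ∷_) (shuffles (x ∷ u) v)

countᵇ : {X : Set} → (X → Bool) → List X → ℕ
countᵇ p []       = 0
countᵇ p (x ∷ xs) = if p x then suc (countᵇ p xs) else countᵇ p xs

-- The product in NCSym^*.
-- Subsets S of [N] with k elements, as characteristic lists of length N.

subsetsOfSize : ℕ → ℕ → List (List Bool)
subsetsOfSize k       zero    = if k ≡ᵇ 0 then [] ∷ [] else []
subsetsOfSize zero    (suc N) = map (false ∷_) (subsetsOfSize zero N)
subsetsOfSize (suc k) (suc N) =
  map (true ∷_) (subsetsOfSize k N) ++ map (false ∷_) (subsetsOfSize (suc k) N)

-- A↑_S ∪ B↑_{[N]∖S}: positions in S receive the blocks of A in order,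
-- positions outside S receive the blocks of B in order (disjoint labels).
merge : List Bool → Part → Part → Part
merge []            _        _        = []
merge (true ∷ s)    (a ∷ as) bs       = 2 * a ∷ merge s as bs
merge (true ∷ s)    []       bs       = []
merge (false ∷ s)   as       (b ∷ bs) = suc (2 * b) ∷ merge s as bs
merge (false ∷ s)   as       []       = []

-- coefficient of w_P in  w_A w_B = Σ_{S ∈ binom([n+m],n)} w_{A↑S ∪ B↑([n+m]∖S)}
productCoeff : Part → Part → Part → ℕ
productCoeff A B P =
  countᵇ (λ S → merge S A B ≈ᵇ P)
         (subsetsOfSize (length A) (length A + length B))

-- coefficient of w_P in  Σ_{u ∈ u₁ ⧢ u₂} w_{C(u)},  C(u)^! = u
shuffleCoeff : List Part → List Part → Part → ℕ
shuffleCoeff u₁ u₂ P = countᵇ (λ u → concatW u ≈ᵇ P) (shuffles u₁ u₂)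

module Submission where

-- Each subset S of [n + m] of size n contributes the merge C_S = A↑S ∪ B↑([n + m] ∖ S) to w_A w_B.
-- A shuffle u of A^! and B^! determines the subset S_u of positions taken by the letters of A^!, and
-- C_{S_u} = C(u); since atomic partitions are nonempty, different shuffles give different subsets, so
-- the shuffle terms form a sub-sum and the remaining terms have nonnegative coefficients.  Conversely,
-- if C_S = D^(1)|⋯|D^(r), the first factor D^(1) occupies an initial segment of positions, on which S
-- selects initial segments of A and of B that are cut off disjointly from the rest.  Atomicity forces
-- these cuts to be factor boundaries of A^! and B^!, together taking at least one letter.  By induction
-- r ≤ ℓ(A^!) + ℓ(B^!), with equality only if every factor takes exactly one letter, i.e. S = S_u.

open import Defs
open import Data.Bool using (Bool; true; false; _∧_; _∨_; not; if_then_else_)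
open import Data.Bool.Properties using (_≟_; ∧-conicalˡ; ∧-conicalʳ; ∧-distribˡ-∨; ∧-zeroʳ; ∧-identityʳ; ⇔→≡; T-≡)
open import Data.Empty using (⊥-elim)
open import Data.List using (List; []; _∷_; _++_; map; length; applyUpTo; take; drop; replicate)
open import Data.List.Membership.Propositional using (_∈_)
open import Data.List.Membership.Propositional.Properties using (∈-map⁻; ∈-map⁺; ∈-++⁺ˡ; ∈-++⁺ʳ; ∈-++⁻)
open import Data.List.Properties
  using ( ≡-dec; ∷-injectiveʳ; length-map; length-++; length-take; length-drop; take-map; drop-map
        ; take++drop≡id; ++-cancelˡ)
open import Data.List.Relation.Binary.Disjoint.Propositional using (Disjoint)
open import Data.List.Relation.Binary.Pointwise as Pointwise using (Pointwise; []; _∷_)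
open import Data.List.Relation.Binary.Subset.Propositional using (_⊆_)
open import Data.List.Relation.Unary.All as All using (All; []; _∷_)
open import Data.List.Relation.Unary.All.Properties using (All¬⇒¬Any; ++⁻ʳ)
open import Data.List.Relation.Unary.Any using (here; there)
open import Data.List.Relation.Unary.Unique.Propositional using (Unique; []; _∷_)
import Data.List.Relation.Unary.Unique.Propositional.Properties as Unique
open import Data.Nat using (ℕ; zero; suc; _+_; _*_; _∸_; _<_; _≤_; _≡ᵇ_; z≤n; s≤s; s≤s⁻¹)
open import Data.Nat.ListAction using (sum)
open import Data.Nat.Properties
  using ( ≡ᵇ⇒≡; ≡⇒≡ᵇ; *-cancelˡ-≡; suc-injective; even≢odd; +-cancelˡ-<; +-cancelˡ-≤; +-cancelʳ-≤; +-cancelˡ-≡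
        ; +-monoʳ-<; +-mono-≤; ≤-trans; ≤-antisym; <⇒≤; m≤m+n; m≤n⇒m⊓n≡m; m⊓n≤n; m+n∸m≡n; +-suc; +-identityʳ
        ; +-commutativeSemigroup; module ≤-Reasoning)
open import Algebra.Properties.CommutativeSemigroup +-commutativeSemigroup using (interchange)
open import Data.Product as Product using (Σ; _×_; _,_; proj₁; proj₂)
open import Data.Sum using (inj₁; inj₂)
open import Function using (_∘_; _$_; id; case_of_)
open import Function.Bundles using (mk⇔; Equivalence)
open import Function.Definitions using (Injective)
open import Relation.Binary.Definitions using (DecidableEquality)
open import Relation.Binary.PropositionalEquality
open import Relation.Nullary using (¬_; does; yes; no)
open import Relation.Nullary.Decidable using (dec-true; dec-false)

≡ᵇ-true⇒≡ : ∀ {m n} → (m ≡ᵇ n) ≡ true → m ≡ n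
≡ᵇ-true⇒≡ {m} {n} e = ≡ᵇ⇒≡ m n (Equivalence.from T-≡ e)

≡⇒≡ᵇ-true : ∀ {m n} → m ≡ n → (m ≡ᵇ n) ≡ true
≡⇒≡ᵇ-true {m} {n} e = Equivalence.to T-≡ (≡⇒≡ᵇ m n e)

≡ᵇ-cong : ∀ {m n m′ n′} → (m ≡ n → m′ ≡ n′) → (m′ ≡ n′ → m ≡ n) → (m ≡ᵇ n) ≡ (m′ ≡ᵇ n′)
≡ᵇ-cong f g = ⇔→≡ (mk⇔ (≡⇒≡ᵇ-true ∘ f ∘ ≡ᵇ-true⇒≡) (≡⇒≡ᵇ-true ∘ g ∘ ≡ᵇ-true⇒≡))

≡ᵇ-injective : ∀ {f : ℕ → ℕ} → Injective _≡_ _≡_ f → ∀ m n → (f m ≡ᵇ f n) ≡ (m ≡ᵇ n)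
≡ᵇ-injective {f} f-inj m n = ≡ᵇ-cong f-inj (cong f)

≡ᵇ-sym : ∀ m n → (m ≡ᵇ n) ≡ (n ≡ᵇ m)
≡ᵇ-sym m n = ≡ᵇ-cong {m} {n} sym sym

≢⇒≡ᵇ-false : ∀ {m n} → ¬ m ≡ n → (m ≡ᵇ n) ≡ false
≢⇒≡ᵇ-false {m} {n} m≢n = ≡ᵇ-cong {m} {n} {0} {1} (⊥-elim ∘ m≢n) λ ()

allᵇ-applyUpTo⁻ : ∀ (p : ℕ → Bool) f n → allᵇ p (applyUpTo f n) ≡ true → ∀ {i} → i < n → p (f i) ≡ true
allᵇ-applyUpTo⁻ p f (suc n) all {zero}  _         = ∧-conicalˡ _ _ all
allᵇ-applyUpTo⁻ p f (suc n) all {suc i} (s≤s i<n) = allᵇ-applyUpTo⁻ p (f ∘ suc) n (∧-conicalʳ _ _ all) i<n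

allᵇ-applyUpTo⁺ : ∀ (p : ℕ → Bool) f n → (∀ {i} → i < n → p (f i) ≡ true) → allᵇ p (applyUpTo f n) ≡ true
allᵇ-applyUpTo⁺ p f zero    _   = refl
allᵇ-applyUpTo⁺ p f (suc n) all =
  cong₂ _∧_ (all (s≤s z≤n)) (allᵇ-applyUpTo⁺ p (f ∘ suc) n (all ∘ s≤s))

length-take-≤ : ∀ {A : Set} {i} (X : List A) → i ≤ length X → length (take i X) ≡ i
length-take-≤ {i = i} X i≤ = trans (length-take i X) (m≤n⇒m⊓n≡m i≤)

length-take-drop : ∀ {A : Set} (X : List A) {i m} → i + m ≡ length X → length (take i X) ≡ i × length (drop i X) ≡ m
length-take-drop X {i} {m} i+m≡∣X∣ =
  length-take-≤ X (subst (i ≤_) i+m≡∣X∣ (m≤m+n i m)) ,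
  trans (length-drop i X) (trans (cong (_∸ i) (sym i+m≡∣X∣)) (m+n∸m≡n i m))

module _ {A : Set} where

  take-++ˡ : ∀ {i} (X Y : List A) → i ≤ length X → take i (X ++ Y) ≡ take i X
  take-++ˡ {zero}  X       Y _         = refl
  take-++ˡ {suc i} (x ∷ X) Y (s≤s i≤) = cong (x ∷_) (take-++ˡ X Y i≤)

  drop-++ˡ : ∀ {i} (X Y : List A) → i ≤ length X → drop i (X ++ Y) ≡ drop i X ++ Y
  drop-++ˡ {zero}  X       Y _         = refl
  drop-++ˡ {suc i} (x ∷ X) Y (s≤s i≤) = drop-++ˡ X Y i≤

  take-++ʳ : ∀ (X Y : List A) {n} → length X ≡ n → ∀ j → take (n + j) (X ++ Y) ≡ X ++ take j Y
  take-++ʳ []      Y refl j = refl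
  take-++ʳ (x ∷ X) Y refl j = cong (x ∷_) (take-++ʳ X Y refl j)

  drop-++ʳ : ∀ (X Y : List A) {n} → length X ≡ n → ∀ j → drop (n + j) (X ++ Y) ≡ drop j Y
  drop-++ʳ []      Y refl j = refl
  drop-++ʳ (x ∷ X) Y refl j = drop-++ʳ X Y refl j

  <-++ʳ⁻ : ∀ (X Y : List A) {j} → length X + j < length (X ++ Y) → j < length Y
  <-++ʳ⁻ X Y lt = +-cancelˡ-< (length X) _ _ (subst (_ <_) (length-++ X) lt)

  <-++ˡ⁺ : ∀ (X Y : List A) {i} → i < length X → i < length (X ++ Y)
  <-++ˡ⁺ X Y i< = subst (_ <_) (sym (length-++ X)) (≤-trans i< (m≤m+n _ _))

  <-++ʳ⁺ : ∀ (X Y : List A) {j} → j < length Y → length X + j < length (X ++ Y)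
  <-++ʳ⁺ X Y j< = subst (_ <_) (sym (length-++ X)) (+-monoʳ-< (length X) j<)

data Offset (n : ℕ) : ℕ → Set where
  below : ∀ {i} → i < n → Offset n i
  above : ∀ j → Offset n (n + j)

offset : ∀ n i → Offset n i
offset zero    i       = above i
offset (suc n) zero    = below (s≤s z≤n)
offset (suc n) (suc i) with offset n i
... | below i<n = below (s≤s i<n)
... | above j   = above j

module _ {X : Set} where

  countᵇ-cong : ∀ {p q : X → Bool} → (∀ x → p x ≡ q x) → ∀ M → countᵇ p M ≡ countᵇ q M
  countᵇ-cong p≡q []      = refl
  countᵇ-cong p≡q (x ∷ M) = cong₂ (λ b n → if b then suc n else n) (p≡q x) (countᵇ-cong p≡q M)

  countᵇ-++ : ∀ (p : X → Bool) M N → countᵇ p (M ++ N) ≡ countᵇ p M + countᵇ p N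
  countᵇ-++ p []      N = refl
  countᵇ-++ p (x ∷ M) N with p x
  ... | true  = cong suc (countᵇ-++ p M N)
  ... | false = countᵇ-++ p M N

  countᵇ-split : ∀ (p q : X → Bool) M →
    countᵇ p M ≡ countᵇ (λ x → p x ∧ q x) M + countᵇ (λ x → p x ∧ not (q x)) M
  countᵇ-split p q []      = refl
  countᵇ-split p q (x ∷ M) with p x | q x
  ... | true  | true  = cong suc (countᵇ-split p q M)
  ... | true  | false = trans (cong suc (countᵇ-split p q M)) (sym (+-suc _ _))
  ... | false | _     = countᵇ-split p q M

  countᵇ-∨ : ∀ {q r : X → Bool} → (∀ x → q x ≡ true → r x ≡ false) →
    ∀ M → countᵇ (λ x → q x ∨ r x) M ≡ countᵇ q M + countᵇ r M
  countᵇ-∨                 q∩r≡∅ []      = refl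
  countᵇ-∨ {q = q} {r} q∩r≡∅ (x ∷ M) with q x in qx | r x in rx
  ... | true  | true  = case trans (sym rx) (q∩r≡∅ x qx) of λ ()
  ... | true  | false = cong suc (countᵇ-∨ q∩r≡∅ M)
  ... | false | true  = trans (cong suc (countᵇ-∨ q∩r≡∅ M)) (sym (+-suc _ _))
  ... | false | false = countᵇ-∨ q∩r≡∅ M

  countᵇ-none : ∀ {p : X → Bool} M → (∀ {x} → x ∈ M → p x ≡ false) → countᵇ p M ≡ 0
  countᵇ-none []      _       = refl
  countᵇ-none (x ∷ M) none rewrite none (here refl) = countᵇ-none M (none ∘ there)

module _ {X : Set} (_≟ₓ_ : DecidableEquality X) where
  open import Data.List.Membership.DecPropositional _≟ₓ_ using (_∈?_)

  countᵇ-≟ : ∀ (p : X → Bool) {l M} → Unique M → l ∈ M →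
    countᵇ (λ x → p x ∧ does (x ≟ₓ l)) M ≡ countᵇ p (l ∷ [])
  countᵇ-≟ p {M = m ∷ M} (m∉M ∷ _) (here refl) rewrite dec-true (m ≟ₓ m) refl | ∧-identityʳ (p m) =
    cong (λ n → if p m then suc n else n) (countᵇ-none M λ {x} x∈M →
      trans (cong (p x ∧_) (dec-false (x ≟ₓ m) λ { refl → All.lookup m∉M x∈M refl })) (∧-zeroʳ (p x)))
  countᵇ-≟ p {l} {m ∷ M} (m∉M ∷ M-unique) (there l∈M)
    rewrite dec-false (m ≟ₓ l) (λ { refl → All.lookup m∉M l∈M refl }) | ∧-zeroʳ (p m) =
    countᵇ-≟ p M-unique l∈M

  countᵇ-∈ : ∀ (p : X → Bool) {L M} → Unique L → Unique M → L ⊆ M →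
    countᵇ (λ x → p x ∧ does (x ∈? L)) M ≡ countᵇ p L
  countᵇ-∈ p {[]}    {M} _                 _        _   = countᵇ-none M λ {x} _ → ∧-zeroʳ (p x)
  countᵇ-∈ p {l ∷ L} {M} (l∉L ∷ L-unique) M-unique L⊆M = begin
    countᵇ (λ x → p x ∧ (does (x ≟ₓ l) ∨ does (x ∈? L))) M
      ≡⟨ countᵇ-cong (λ x → ∧-distribˡ-∨ (p x) _ _) M ⟩
    countᵇ (λ x → (p x ∧ does (x ≟ₓ l)) ∨ (p x ∧ does (x ∈? L))) M
      ≡⟨ countᵇ-∨ at-most-one M ⟩
    countᵇ (λ x → p x ∧ does (x ≟ₓ l)) M + countᵇ (λ x → p x ∧ does (x ∈? L)) M
      ≡⟨ cong₂ _+_ (countᵇ-≟ p M-unique (L⊆M (here refl))) (countᵇ-∈ p L-unique M-unique (L⊆M ∘ there)) ⟩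
    countᵇ p (l ∷ []) + countᵇ p L
      ≡⟨ countᵇ-++ p (l ∷ []) L ⟨
    countᵇ p (l ∷ L) ∎
    where
    open ≡-Reasoning
    at-most-one : ∀ x → (p x ∧ does (x ≟ₓ l)) ≡ true → (p x ∧ does (x ∈? L)) ≡ false
    at-most-one x _ with x ≟ₓ l
    at-most-one x _ | yes refl = trans (cong (p x ∧_) (dec-false (x ∈? L) (All¬⇒¬Any l∉L))) (∧-zeroʳ (p x))
    at-most-one x e | no _     = case trans (sym e) (∧-zeroʳ (p x)) of λ ()

  countᵇOutside : (X → Bool) → List X → List X → ℕ
  countᵇOutside p L M = countᵇ (λ x → p x ∧ not (does (x ∈? L))) M

  countᵇ-⊆ : ∀ (p : X → Bool) {L M} → Unique L → Unique M → L ⊆ M →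
    countᵇ p M ≡ countᵇ p L + countᵇOutside p L M
  countᵇ-⊆ p {L} {M} L-unique M-unique L⊆M = trans (countᵇ-split p (λ x → does (x ∈? L)) M)
    (cong (_+ countᵇOutside p L M) (countᵇ-∈ p L-unique M-unique L⊆M))

  countᵇOutside≡0 : ∀ (p : X → Bool) {L M} → (∀ {x} → x ∈ M → p x ≡ true → x ∈ L) → countᵇOutside p L M ≡ 0
  countᵇOutside≡0 p {L} {M} inside = countᵇ-none M λ {x} x∈M → outside-false x x∈M
    where
    outside-false : ∀ x → x ∈ M → (p x ∧ not (does (x ∈? L))) ≡ false
    outside-false x x∈M with p x in px
    ... | false = refl
    ... | true  = cong not (dec-true (x ∈? L) (inside x∈M px))

countᵇ-Pointwise : ∀ {X Y : Set} {R : X → Y → Set} {p : X → Bool} {q : Y → Bool} →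
  (∀ {x y} → R x y → p x ≡ q y) → ∀ {xs ys} → Pointwise R xs ys → countᵇ p xs ≡ countᵇ q ys
countᵇ-Pointwise p≡q []       = refl
countᵇ-Pointwise p≡q (r ∷ rs) = cong₂ (λ b n → if b then suc n else n) (p≡q r) (countᵇ-Pointwise p≡q rs)

∈-Pointwiseʳ : ∀ {X Y : Set} {R : X → Y → Set} {xs ys y} → Pointwise R xs ys → y ∈ ys → Σ X λ x → R x y
∈-Pointwiseʳ (r ∷ _)  (here refl) = _ , r
∈-Pointwiseʳ (_ ∷ rs) (there y∈)  = ∈-Pointwiseʳ rs y∈

tight-sum : ∀ {p s n} → 0 < p → n ≤ s → p + s ≤ suc n → p ≡ 1 × s ≤ n
tight-sum {p} {s} {n} 0<p n≤s p+s≤ = p≡1 , s≤s⁻¹ (subst (λ q → q + s ≤ suc n) p≡1 p+s≤)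
  where
  p≡1 : p ≡ 1
  p≡1 = ≤-antisym (+-cancelʳ-≤ s p 1 (≤-trans p+s≤ (s≤s n≤s))) 0<p

-- Set partitions up to relabelling

kernel : Part → ℕ → ℕ → Bool
kernel X i j = X ! i ≡ᵇ X ! j

kernel-sym : ∀ X i j → kernel X i j ≡ kernel X j i
kernel-sym X i j = ≡ᵇ-sym (X ! i) (X ! j)

infix 4 _≈_
record _≈_ (X Y : Part) : Set where
  constructor mk≈
  field
    length≡ : length X ≡ length Y
    kernel≡ : ∀ {i j} → i < length X → j < length X → kernel X i j ≡ kernel Y i j
open _≈_

≈-refl : ∀ {X} → X ≈ X
≈-refl = mk≈ refl (λ _ _ → refl)

≈-sym : ∀ {X Y} → X ≈ Y → Y ≈ X
≈-sym (mk≈ ∣X∣≡∣Y∣ ker) = mk≈ (sym ∣X∣≡∣Y∣) λ i< j< → sym (ker (back i<) (back j<))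
  where
  back : ∀ {i} → i < _ → i < _
  back = subst (_ <_) (sym ∣X∣≡∣Y∣)

≈-trans : ∀ {X Y Z} → X ≈ Y → Y ≈ Z → X ≈ Z
≈-trans (mk≈ ∣X∣≡∣Y∣ ker) (mk≈ ∣Y∣≡∣Z∣ ker′) =
  mk≈ (trans ∣X∣≡∣Y∣ ∣Y∣≡∣Z∣) λ i< j< → trans (ker i< j<) (ker′ (forth i<) (forth j<))
  where
  forth : ∀ {i} → i < _ → i < _
  forth = subst (_ <_) ∣X∣≡∣Y∣

≈ᵇ⇒≈ : ∀ {X Y} → (X ≈ᵇ Y) ≡ true → X ≈ Y
≈ᵇ⇒≈ X≈ᵇY = mk≈ (≡ᵇ-true⇒≡ (∧-conicalˡ _ _ X≈ᵇY)) λ i< j< →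
  ⇔ᵇ-true⇒≡ (allᵇ-applyUpTo⁻ _ id _ (allᵇ-applyUpTo⁻ _ id _ (∧-conicalʳ _ _ X≈ᵇY) i<) j<)
  where
  ⇔ᵇ-true⇒≡ : ∀ {a b} → (a ⇔ᵇ b) ≡ true → a ≡ b
  ⇔ᵇ-true⇒≡ {false} {false} _ = refl
  ⇔ᵇ-true⇒≡ {true}  {true}  _ = refl

≈⇒≈ᵇ : ∀ {X Y} → X ≈ Y → (X ≈ᵇ Y) ≡ true
≈⇒≈ᵇ (mk≈ ∣X∣≡∣Y∣ ker) = cong₂ _∧_ (≡⇒≡ᵇ-true ∣X∣≡∣Y∣)
  (allᵇ-applyUpTo⁺ _ id _ λ i< → allᵇ-applyUpTo⁺ _ id _ λ j< → ≡⇒⇔ᵇ-true (ker i< j<))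
  where
  ≡⇒⇔ᵇ-true : ∀ {a b} → a ≡ b → (a ⇔ᵇ b) ≡ true
  ≡⇒⇔ᵇ-true {false} refl = refl
  ≡⇒⇔ᵇ-true {true}  refl = refl

≈ᵇ-congˡ : ∀ {X Y} P → X ≈ Y → (X ≈ᵇ P) ≡ (Y ≈ᵇ P)
≈ᵇ-congˡ P X≈Y = ⇔→≡ (mk⇔ (λ X≈ᵇP → ≈⇒≈ᵇ (≈-trans (≈-sym X≈Y) (≈ᵇ⇒≈ {Y = P} X≈ᵇP)))
                         (λ Y≈ᵇP → ≈⇒≈ᵇ (≈-trans X≈Y (≈ᵇ⇒≈ {Y = P} Y≈ᵇP))))

!-++ˡ : ∀ (X Y : Part) {i} → i < length X → (X ++ Y) ! i ≡ X ! i
!-++ˡ (x ∷ X) Y {zero}  _         = refl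
!-++ˡ (x ∷ X) Y {suc i} (s≤s i<n) = !-++ˡ X Y i<n

!-++ʳ : ∀ (X Y : Part) j → (X ++ Y) ! (length X + j) ≡ Y ! j
!-++ʳ []      Y j = refl
!-++ʳ (x ∷ X) Y j = !-++ʳ X Y j

!-map : ∀ (f : ℕ → ℕ) X {i} → i < length X → map f X ! i ≡ f (X ! i)
!-map f (x ∷ X) {zero}  _         = refl
!-map f (x ∷ X) {suc i} (s≤s i<n) = !-map f X i<n

!-∈ : ∀ X {i} → i < length X → X ! i ∈ X
!-∈ (x ∷ X) {zero}  _         = here refl
!-∈ (x ∷ X) {suc i} (s≤s i<n) = there (!-∈ X i<n)

∈⇒! : ∀ {v} X → v ∈ X → Σ ℕ λ i → i < length X × X ! i ≡ v
∈⇒! (x ∷ X) (here refl) = zero , s≤s z≤n , refl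
∈⇒! (x ∷ X) (there v∈X) with ∈⇒! X v∈X
... | i , i< , Xi≡v = suc i , s≤s i< , Xi≡v

map-≈ : ∀ {f} → Injective _≡_ _≡_ f → ∀ X → map f X ≈ X
map-≈ {f} f-inj X = mk≈ (length-map f X) λ i< j< →
  trans (cong₂ _≡ᵇ_ (!-map f X (bound i<)) (!-map f X (bound j<))) (≡ᵇ-injective f-inj _ _)
  where
  bound : ∀ {i} → i < length (map f X) → i < length X
  bound = subst (_ <_) (length-map f X)

module _ (X Y : Part) {n} (∣X∣≡n : length X ≡ n) where

  kernel-++ˡ : ∀ {i j} → i < n → j < n → kernel (X ++ Y) i j ≡ kernel X i j
  kernel-++ˡ i< j< = cong₂ _≡ᵇ_ (!-++ˡ X Y (<n i<)) (!-++ˡ X Y (<n j<))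
    where
    <n : ∀ {i} → i < n → i < length X
    <n = subst (_ <_) (sym ∣X∣≡n)

  kernel-++ʳ : ∀ i j → kernel (X ++ Y) (n + i) (n + j) ≡ kernel Y i j
  kernel-++ʳ i j rewrite sym ∣X∣≡n = cong₂ _≡ᵇ_ (!-++ʳ X Y i) (!-++ʳ X Y j)

  kernel-++-disjoint : Disjoint X Y → ∀ {i j} → i < n → j < length Y → kernel (X ++ Y) i (n + j) ≡ false
  kernel-++-disjoint X∩Y≡∅ {i} {j} i< j< rewrite sym ∣X∣≡n =
    trans (cong₂ _≡ᵇ_ (!-++ˡ X Y i<) (!-++ʳ X Y j))
          (≢⇒≡ᵇ-false λ Xi≡Yj → X∩Y≡∅ (!-∈ X i< , subst (_∈ Y) (sym Xi≡Yj) (!-∈ Y j<)))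

++-≈ : ∀ {X X′ Y Y′ : Part} → X ≈ X′ → Y ≈ Y′ → Disjoint X Y → Disjoint X′ Y′ → X ++ Y ≈ X′ ++ Y′
++-≈ {X} {X′} {Y} {Y′} X≈X′ Y≈Y′ X∩Y≡∅ X′∩Y′≡∅ = mk≈ ∣XY∣≡∣X′Y′∣ ker
  where
  ∣XY∣≡∣X′Y′∣ : length (X ++ Y) ≡ length (X′ ++ Y′)
  ∣XY∣≡∣X′Y′∣ = trans (length-++ X) (trans (cong₂ _+_ (length≡ X≈X′) (length≡ Y≈Y′)) (sym (length-++ X′)))
  ∣X′∣≡∣X∣ : length X′ ≡ length X
  ∣X′∣≡∣X∣ = sym (length≡ X≈X′)
  Y′-bound : ∀ {j} → j < length Y → j < length Y′
  Y′-bound = subst (_ <_) (length≡ Y≈Y′)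
  cross : ∀ {i j} → i < length X → j < length Y → kernel (X ++ Y) i (length X + j) ≡ kernel (X′ ++ Y′) i (length X + j)
  cross i< j< = trans (kernel-++-disjoint X Y refl X∩Y≡∅ i< j<)
                      (sym (kernel-++-disjoint X′ Y′ ∣X′∣≡∣X∣ X′∩Y′≡∅ i< (Y′-bound j<)))
  ker : ∀ {i j} → i < length (X ++ Y) → j < length (X ++ Y) → kernel (X ++ Y) i j ≡ kernel (X′ ++ Y′) i j
  ker {i} {j} i< j< with offset (length X) i | offset (length X) j
  ... | below i<′ | below j<′ =
    trans (kernel-++ˡ X Y refl i<′ j<′)
          (trans (kernel≡ X≈X′ i<′ j<′) (sym (kernel-++ˡ X′ Y′ ∣X′∣≡∣X∣ i<′ j<′)))
  ... | below i<′ | above q = cross i<′ (<-++ʳ⁻ X Y j<)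
  ... | above p   | below j<′ =
    trans (kernel-sym (X ++ Y) _ j) (trans (cross j<′ (<-++ʳ⁻ X Y i<)) (kernel-sym (X′ ++ Y′) j _))
  ... | above p   | above q =
    trans (kernel-++ʳ X Y refl p q)
          (trans (kernel≡ Y≈Y′ (<-++ʳ⁻ X Y i<) (<-++ʳ⁻ X Y j<)) (sym (kernel-++ʳ X′ Y′ ∣X′∣≡∣X∣ p q)))

module _ {X X′ Y Y′ : Part} (∣X∣≡∣X′∣ : length X ≡ length X′) (XY≈X′Y′ : X ++ Y ≈ X′ ++ Y′) where

  ≈-++⁻ʳ : Y ≈ Y′
  ≈-++⁻ʳ = mk≈ ∣Y∣≡∣Y′∣ λ {p} {q} p< q< →
    trans (sym (kernel-++ʳ X Y refl p q))
          (trans (kernel≡ XY≈X′Y′ (<-++ʳ⁺ X Y p<) (<-++ʳ⁺ X Y q<)) (kernel-++ʳ X′ Y′ (sym ∣X∣≡∣X′∣) p q))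
    where
    ∣Y∣≡∣Y′∣ : length Y ≡ length Y′
    ∣Y∣≡∣Y′∣ = +-cancelˡ-≡ (length X) _ _ (begin
      length X + length Y   ≡⟨ length-++ X ⟨
      length (X ++ Y)       ≡⟨ length≡ XY≈X′Y′ ⟩
      length (X′ ++ Y′)     ≡⟨ length-++ X′ ⟩
      length X′ + length Y′ ≡⟨ cong (_+ length Y′) (sym ∣X∣≡∣X′∣) ⟩
      length X + length Y′  ∎)
      where open ≡-Reasoning

  ≈-++-disjoint : Disjoint X′ Y′ → Disjoint X Y
  ≈-++-disjoint X′∩Y′≡∅ (v∈X , v∈Y) with ∈⇒! X v∈X | ∈⇒! Y v∈Y
  ... | p , p< , Xp≡v | q , q< , Yq≡v = false≢true (begin
    false                                   ≡⟨ kernel-++-disjoint X′ Y′ (sym ∣X∣≡∣X′∣) X′∩Y′≡∅ p< q<′ ⟨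
    kernel (X′ ++ Y′) p (length X + q)      ≡⟨ kernel≡ XY≈X′Y′ (<-++ˡ⁺ X Y p<) (<-++ʳ⁺ X Y q<) ⟨
    kernel (X ++ Y) p (length X + q)        ≡⟨ cong₂ _≡ᵇ_ (!-++ˡ X Y p<) (!-++ʳ X Y q) ⟩
    X ! p ≡ᵇ Y ! q                          ≡⟨ ≡⇒≡ᵇ-true (trans Xp≡v (sym Yq≡v)) ⟩
    true                                    ∎)
    where
    open ≡-Reasoning
    q<′ : q < length Y′
    q<′ = subst (q <_) (length≡ ≈-++⁻ʳ) q<
    false≢true : false ≢ true
    false≢true ()

-- Atomic factorisations

tagˡ tagʳ : ℕ → ℕ
tagˡ a = 2 * a
tagʳ b = suc (2 * b)

tagˡ-injective : Injective _≡_ _≡_ tagˡ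
tagˡ-injective = *-cancelˡ-≡ _ _ 2

tagʳ-injective : Injective _≡_ _≡_ tagʳ
tagʳ-injective = tagˡ-injective ∘ suc-injective

tags-disjoint : ∀ X Y → Disjoint (map tagˡ X) (map tagʳ Y)
tags-disjoint X Y (v∈X , v∈Y) with ∈-map⁻ tagˡ v∈X | ∈-map⁻ tagʳ v∈Y
... | a , _ , refl | b , _ , 2a≡2b+1 = even≢odd a b 2a≡2b+1

∣-≈-++ : ∀ {X Y} → Disjoint X Y → X ++ Y ≈ X ∣ Y
∣-≈-++ {X} {Y} X∩Y≡∅ =
  ++-≈ (≈-sym (map-≈ tagˡ-injective X)) (≈-sym (map-≈ tagʳ-injective Y)) X∩Y≡∅ (tags-disjoint X Y)

Atomic⇒indivisible : ∀ {x i} → Atomic x → 0 < i → i < length x → ¬ Disjoint (take i x) (drop i x)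
Atomic⇒indivisible {x} {i} (_ , no-split) 0<i i<∣x∣ disjoint = no-split
  (i , take i x , drop i x , 0<i , i<∣x∣ , length-take-≤ x (<⇒≤ i<∣x∣) , length-drop i x ,
   ≈⇒≈ᵇ (subst (_≈ take i x ∣ drop i x) (take++drop≡id i x) (∣-≈-++ disjoint)))

size : List Part → ℕ
size = sum ∘ map length

length-concatW : ∀ a → length (concatW a) ≡ size a
length-concatW []      = refl
length-concatW (x ∷ a) = begin
  length (map tagˡ x ++ map tagʳ (concatW a))            ≡⟨ length-++ (map tagˡ x) ⟩
  length (map tagˡ x) + length (map tagʳ (concatW a))    ≡⟨ cong₂ _+_ (length-map tagˡ x) (length-map tagʳ (concatW a)) ⟩
  length x + length (concatW a)                          ≡⟨ cong (length x +_) (length-concatW a) ⟩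
  length x + size a                                      ∎
  where open ≡-Reasoning

drop-size-concatW : ∀ a₁ a₂ → drop (size a₁) (concatW (a₁ ++ a₂)) ≈ concatW a₂
drop-size-concatW []       a₂ = ≈-refl
drop-size-concatW (x ∷ a₁) a₂ = subst (_≈ concatW a₂) (sym drop≡)
  (≈-trans (map-≈ tagʳ-injective (drop (size a₁) (concatW (a₁ ++ a₂)))) (drop-size-concatW a₁ a₂))
  where
  drop≡ : drop (length x + size a₁) (concatW (x ∷ a₁ ++ a₂)) ≡ map tagʳ (drop (size a₁) (concatW (a₁ ++ a₂)))
  drop≡ = trans (drop-++ʳ (map tagˡ x) _ (length-map tagˡ x) (size a₁)) (drop-map (size a₁) _)

record FactorBoundary (a : List Part) (i : ℕ) : Set where
  constructor boundary
  field
    prefix suffix : List Part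
    a≡          : a ≡ prefix ++ suffix
    size-prefix : size prefix ≡ i

  drop-≈-suffix : drop i (concatW a) ≈ concatW suffix
  drop-≈-suffix = subst₂ (λ n w → drop n (concatW w) ≈ concatW suffix) size-prefix (sym a≡)
                         (drop-size-concatW prefix suffix)
open FactorBoundary

factorBoundary : ∀ a i → All Atomic a → i ≤ size a →
  Disjoint (take i (concatW a)) (drop i (concatW a)) → FactorBoundary a i
factorBoundary []      zero _ _ _ = boundary [] [] refl refl
factorBoundary (x ∷ a) i (x-atomic ∷ a-atomic) i≤ disjoint with offset (length x) i
... | below i<∣x∣ = insideFirst i i<∣x∣ disjoint
  where
  insideFirst : ∀ i → i < length x →
    Disjoint (take i (concatW (x ∷ a))) (drop i (concatW (x ∷ a))) → FactorBoundary (x ∷ a) i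
  insideFirst zero    _      _         = boundary [] (x ∷ a) refl refl
  insideFirst (suc i) i<∣x∣ disjoint = ⊥-elim (Atomic⇒indivisible x-atomic (s≤s z≤n) i<∣x∣ λ {v} (v∈take , v∈drop) →
      disjoint (subst (tagˡ v ∈_) (sym take≡) (∈-map⁺ tagˡ v∈take) ,
                subst (tagˡ v ∈_) (sym drop≡) (∈-++⁺ˡ (∈-map⁺ tagˡ v∈drop))))
    where
    i≤∣x∣ : suc i ≤ length (map tagˡ x)
    i≤∣x∣ = <⇒≤ (subst (_ <_) (sym (length-map tagˡ x)) i<∣x∣)
    take≡ : take (suc i) (concatW (x ∷ a)) ≡ map tagˡ (take (suc i) x)
    take≡ = trans (take-++ˡ (map tagˡ x) _ i≤∣x∣) (take-map (suc i) x)
    drop≡ : drop (suc i) (concatW (x ∷ a)) ≡ map tagˡ (drop (suc i) x) ++ map tagʳ (concatW a)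
    drop≡ = trans (drop-++ˡ (map tagˡ x) _ i≤∣x∣) (cong (_++ _) (drop-map (suc i) x))
... | above j = extend (factorBoundary a j a-atomic (+-cancelˡ-≤ (length x) j (size a) i≤) disjoint′)
  where
  take≡ : take (length x + j) (concatW (x ∷ a)) ≡ map tagˡ x ++ map tagʳ (take j (concatW a))
  take≡ = trans (take-++ʳ (map tagˡ x) _ (length-map tagˡ x) j) (cong (map tagˡ x ++_) (take-map j _))
  drop≡ : drop (length x + j) (concatW (x ∷ a)) ≡ map tagʳ (drop j (concatW a))
  drop≡ = trans (drop-++ʳ (map tagˡ x) _ (length-map tagˡ x) j) (drop-map j _)
  disjoint′ : Disjoint (take j (concatW a)) (drop j (concatW a))
  disjoint′ {v} (v∈take , v∈drop) =
    disjoint (subst (tagʳ v ∈_) (sym take≡) (∈-++⁺ʳ (map tagˡ x) (∈-map⁺ tagʳ v∈take)) ,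
              subst (tagʳ v ∈_) (sym drop≡) (∈-map⁺ tagʳ v∈drop))
  extend : FactorBoundary a j → FactorBoundary (x ∷ a) (length x + j)
  extend (boundary a₁ a₂ a≡ size≡j) = boundary (x ∷ a₁) a₂ (cong (x ∷_) a≡) (cong (length x +_) size≡j)

NonEmpty : Part → Set
NonEmpty x = 0 < length x

All-suffix : ∀ {P : Part → Set} {a i} → All P a → (fb : FactorBoundary a i) → All P (suffix fb)
All-suffix all fb = ++⁻ʳ (prefix fb) (subst (All _) (a≡ fb) all)

-- Merging two set partitions along a subset

nTrue nFalse : List Bool → ℕ
nTrue []          = 0
nTrue (true ∷ S)  = suc (nTrue S)
nTrue (false ∷ S) = nTrue S
nFalse []          = 0
nFalse (true ∷ S)  = nFalse S
nFalse (false ∷ S) = suc (nFalse S)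

length≡nTrue+nFalse : ∀ S → length S ≡ nTrue S + nFalse S
length≡nTrue+nFalse []          = refl
length≡nTrue+nFalse (true ∷ S)  = cong suc (length≡nTrue+nFalse S)
length≡nTrue+nFalse (false ∷ S) = trans (cong suc (length≡nTrue+nFalse S)) (sym (+-suc (nTrue S) (nFalse S)))

nTrue-++ : ∀ S₁ S₂ → nTrue (S₁ ++ S₂) ≡ nTrue S₁ + nTrue S₂
nTrue-++ []           S₂ = refl
nTrue-++ (true ∷ S₁)  S₂ = cong suc (nTrue-++ S₁ S₂)
nTrue-++ (false ∷ S₁) S₂ = nTrue-++ S₁ S₂

nFalse-++ : ∀ S₁ S₂ → nFalse (S₁ ++ S₂) ≡ nFalse S₁ + nFalse S₂
nFalse-++ []           S₂ = refl
nFalse-++ (true ∷ S₁)  S₂ = nFalse-++ S₁ S₂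
nFalse-++ (false ∷ S₁) S₂ = cong suc (nFalse-++ S₁ S₂)

trues falses : ℕ → List Bool
trues n = replicate n true
falses n = replicate n false

nFalse≡0⇒trues : ∀ S → nFalse S ≡ 0 → S ≡ trues (nTrue S)
nFalse≡0⇒trues []         _ = refl
nFalse≡0⇒trues (true ∷ S) e = cong (true ∷_) (nFalse≡0⇒trues S e)

nTrue≡0⇒falses : ∀ S → nTrue S ≡ 0 → S ≡ falses (nFalse S)
nTrue≡0⇒falses []          _ = refl
nTrue≡0⇒falses (false ∷ S) e = cong (false ∷_) (nTrue≡0⇒falses S e)

Fits : List Bool → Part → Part → Set
Fits S A B = nTrue S ≡ length A × nFalse S ≡ length B

merge-length : ∀ S A B → Fits S A B → length (merge S A B) ≡ length S
merge-length []          A       B       _       = refl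
merge-length (true ∷ S)  (a ∷ A) B       (e , f) = cong suc (merge-length S A B (suc-injective e , f))
merge-length (false ∷ S) A       (b ∷ B) (e , f) = cong suc (merge-length S A B (e , suc-injective f))

data Origin : Set where
  fromˡ fromʳ : ℕ → Origin

shiftˡ shiftʳ : Origin → Origin
shiftˡ (fromˡ k) = fromˡ (suc k)
shiftˡ (fromʳ k) = fromʳ k
shiftʳ (fromˡ k) = fromˡ k
shiftʳ (fromʳ k) = fromʳ (suc k)

origin : List Bool → ℕ → Origin
origin []          _       = fromˡ 0
origin (true ∷ S)  zero    = fromˡ 0
origin (false ∷ S) zero    = fromʳ 0
origin (true ∷ S)  (suc p) = shiftˡ (origin S p)
origin (false ∷ S) (suc p) = shiftʳ (origin S p)

module _ (A B : Part) where

  InRange : Origin → Set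
  InRange (fromˡ k) = k < length A
  InRange (fromʳ k) = k < length B

  label : Origin → ℕ
  label (fromˡ k) = tagˡ (A ! k)
  label (fromʳ k) = tagʳ (B ! k)

  originKernel : Origin → Origin → Bool
  originKernel (fromˡ k) (fromˡ l) = kernel A k l
  originKernel (fromʳ k) (fromʳ l) = kernel B k l
  originKernel (fromˡ _) (fromʳ _) = false
  originKernel (fromʳ _) (fromˡ _) = false

  label-kernel : ∀ o o′ → (label o ≡ᵇ label o′) ≡ originKernel o o′
  label-kernel (fromˡ k) (fromˡ l) = ≡ᵇ-injective tagˡ-injective (A ! k) (A ! l)
  label-kernel (fromʳ k) (fromʳ l) = ≡ᵇ-injective tagʳ-injective (B ! k) (B ! l)
  label-kernel (fromˡ k) (fromʳ l) = ≢⇒≡ᵇ-false (even≢odd (A ! k) (B ! l))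
  label-kernel (fromʳ k) (fromˡ l) = ≢⇒≡ᵇ-false (even≢odd (A ! l) (B ! k) ∘ sym)

merge-! : ∀ S A B {p} → Fits S A B → p < length S →
  InRange A B (origin S p) × merge S A B ! p ≡ label A B (origin S p)
merge-! (true ∷ S)  (a ∷ A) B {zero}  _       _         = s≤s z≤n , refl
merge-! (false ∷ S) A (b ∷ B) {zero}  _       _         = s≤s z≤n , refl
merge-! (true ∷ S)  (a ∷ A) B {suc p} (e , f) (s≤s p<) with origin S p | merge-! S A B (suc-injective e , f) p<
... | fromˡ k | k< , eq = s≤s k< , eq
... | fromʳ k | k< , eq = k< , eq
merge-! (false ∷ S) A (b ∷ B) {suc p} (e , f) (s≤s p<) with origin S p | merge-! S A B (e , suc-injective f) p<
... | fromˡ k | k< , eq = k< , eq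
... | fromʳ k | k< , eq = s≤s k< , eq

originKernel-cong : ∀ {A A′ B B′} → A ≈ A′ → B ≈ B′ → ∀ o o′ → InRange A B o → InRange A B o′ →
  originKernel A B o o′ ≡ originKernel A′ B′ o o′
originKernel-cong A≈A′ B≈B′ (fromˡ k) (fromˡ l) k< l< = kernel≡ A≈A′ k< l<
originKernel-cong A≈A′ B≈B′ (fromʳ k) (fromʳ l) k< l< = kernel≡ B≈B′ k< l<
originKernel-cong A≈A′ B≈B′ (fromˡ k) (fromʳ l) _  _  = refl
originKernel-cong A≈A′ B≈B′ (fromʳ k) (fromˡ l) _  _  = refl

fits-≈ : ∀ S {A A′ B B′} → Fits S A B → A ≈ A′ → B ≈ B′ → Fits S A′ B′
fits-≈ S (e , f) A≈A′ B≈B′ = trans e (length≡ A≈A′) , trans f (length≡ B≈B′)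

kernel-merge : ∀ S {A B p q} → Fits S A B → p < length S → q < length S →
  kernel (merge S A B) p q ≡ originKernel A B (origin S p) (origin S q)
kernel-merge S {A} {B} {p} {q} fits p< q< =
  trans (cong₂ _≡ᵇ_ (proj₂ (merge-! S A B fits p<)) (proj₂ (merge-! S A B fits q<)))
        (label-kernel A B (origin S p) (origin S q))

merge-≈ : ∀ S {A A′ B B′} → Fits S A B → A ≈ A′ → B ≈ B′ → merge S A B ≈ merge S A′ B′
merge-≈ S {A} {A′} {B} {B′} fits A≈A′ B≈B′ =
  mk≈ (trans (merge-length S A B fits) (sym (merge-length S A′ B′ fits′))) ker
  where
  fits′ : Fits S A′ B′
  fits′ = fits-≈ S fits A≈A′ B≈B′
  ker : ∀ {p q} → p < length (merge S A B) → q < length (merge S A B) →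
        kernel (merge S A B) p q ≡ kernel (merge S A′ B′) p q
  ker {p} {q} p< q< = begin
    kernel (merge S A B) p q                     ≡⟨ kernel-merge S fits p<′ q<′ ⟩
    originKernel A B (origin S p) (origin S q)   ≡⟨ originKernel-cong A≈A′ B≈B′ _ _ (in-range p<′) (in-range q<′) ⟩
    originKernel A′ B′ (origin S p) (origin S q) ≡⟨ kernel-merge S fits′ p<′ q<′ ⟨
    kernel (merge S A′ B′) p q                   ∎
    where
    open ≡-Reasoning
    p<′ : p < length S
    p<′ = subst (p <_) (merge-length S A B fits) p<
    q<′ : q < length S
    q<′ = subst (q <_) (merge-length S A B fits) q<
    in-range : ∀ {i} → i < length S → InRange A B (origin S i)
    in-range i< = proj₁ (merge-! S A B fits i<)

∈-merge⁺ˡ : ∀ S A B {a} → Fits S A B → a ∈ A → tagˡ a ∈ merge S A B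
∈-merge⁺ˡ (true ∷ S)  (x ∷ A) B _       (here refl) = here refl
∈-merge⁺ˡ (true ∷ S)  (x ∷ A) B (e , f) (there a∈A) = there (∈-merge⁺ˡ S A B (suc-injective e , f) a∈A)
∈-merge⁺ˡ (false ∷ S) A (y ∷ B) (e , f) a∈A         = there (∈-merge⁺ˡ S A B (e , suc-injective f) a∈A)

∈-merge⁺ʳ : ∀ S A B {b} → Fits S A B → b ∈ B → tagʳ b ∈ merge S A B
∈-merge⁺ʳ (false ∷ S) A (y ∷ B) _       (here refl) = here refl
∈-merge⁺ʳ (false ∷ S) A (y ∷ B) (e , f) (there b∈B) = there (∈-merge⁺ʳ S A B (e , suc-injective f) b∈B)
∈-merge⁺ʳ (true ∷ S)  (x ∷ A) B (e , f) b∈B         = there (∈-merge⁺ʳ S A B (suc-injective e , f) b∈B)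

module _ (S : List Bool) {A B : Part} (fits : Fits S A B) where

  private
    origin-of : ∀ {v} → v ∈ merge S A B →
      Σ ℕ λ p → InRange A B (origin S p) × label A B (origin S p) ≡ v
    origin-of v∈M with ∈⇒! _ v∈M
    ... | p , p< , Mp≡v with merge-! S A B fits (subst (p <_) (merge-length S A B fits) p<)
    ...   | inRange , Mp≡label = p , inRange , trans (sym Mp≡label) Mp≡v

  merge-disjointˡ : ∀ {X} → Disjoint X A → Disjoint (map tagˡ X) (merge S A B)
  merge-disjointˡ {X} X∩A≡∅ (v∈X′ , v∈M) with ∈-map⁻ tagˡ v∈X′ | origin-of v∈M
  ... | x , x∈X , refl | p , inRange , label≡ with origin S p
  ...   | fromˡ k = X∩A≡∅ (x∈X , subst (_∈ A) (tagˡ-injective label≡) (!-∈ A inRange))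
  ...   | fromʳ k = even≢odd x (B ! k) (sym label≡)

  merge-disjointʳ : ∀ {Y} → Disjoint Y B → Disjoint (map tagʳ Y) (merge S A B)
  merge-disjointʳ {Y} Y∩B≡∅ (v∈Y′ , v∈M) with ∈-map⁻ tagʳ v∈Y′ | origin-of v∈M
  ... | y , y∈Y , refl | p , inRange , label≡ with origin S p
  ...   | fromˡ k = even≢odd (A ! k) y label≡
  ...   | fromʳ k = Y∩B≡∅ (y∈Y , subst (_∈ B) (tagʳ-injective label≡) (!-∈ B inRange))

merge-++ : ∀ S₁ {S₂ A₁ A₂ B₁ B₂} → Fits S₁ A₁ B₁ →
  merge (S₁ ++ S₂) (A₁ ++ A₂) (B₁ ++ B₂) ≡ merge S₁ A₁ B₁ ++ merge S₂ A₂ B₂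
merge-++ []           {A₁ = []}     {B₁ = []}     _       = refl
merge-++ (true ∷ S₁)  {A₁ = a ∷ A₁}               (e , f) = cong (tagˡ a ∷_) (merge-++ S₁ (suc-injective e , f))
merge-++ (false ∷ S₁)               {B₁ = b ∷ B₁} (e , f) = cong (tagʳ b ∷_) (merge-++ S₁ (e , suc-injective f))

merge-trues-++ : ∀ X {n} → length X ≡ n → ∀ S A B → merge (trues n ++ S) (X ++ A) B ≡ map tagˡ X ++ merge S A B
merge-trues-++ []      refl S A B = refl
merge-trues-++ (x ∷ X) refl S A B = cong (tagˡ x ∷_) (merge-trues-++ X refl S A B)

merge-falses-++ : ∀ Y {n} → length Y ≡ n → ∀ S A B → merge (falses n ++ S) A (Y ++ B) ≡ map tagʳ Y ++ merge S A B
merge-falses-++ []      refl S A B = refl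
merge-falses-++ (y ∷ Y) refl S A B = cong (tagʳ y ∷_) (merge-falses-++ Y refl S A B)

fits-trues-++ : ∀ X {n S A B} → length X ≡ n → Fits S A B → Fits (trues n ++ S) (X ++ A) B
fits-trues-++ []                      refl fits = fits
fits-trues-++ (x ∷ X) {S = S} {A} {B} refl fits = Product.map₁ (cong suc) (fits-trues-++ X {S = S} {A} {B} refl fits)

fits-falses-++ : ∀ Y {n S A B} → length Y ≡ n → Fits S A B → Fits (falses n ++ S) A (Y ++ B)
fits-falses-++ []                      refl fits = fits
fits-falses-++ (y ∷ Y) {S = S} {A} {B} refl fits = Product.map₂ (cong suc) (fits-falses-++ Y {S = S} {A} {B} refl fits)

fits-++⁻ : ∀ S₁ {S₂ A B} → Fits (S₁ ++ S₂) A B →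
  Fits S₁ (take (nTrue S₁) A) (take (nFalse S₁) B) × Fits S₂ (drop (nTrue S₁) A) (drop (nFalse S₁) B)
fits-++⁻ S₁ {S₂} {A} {B} (e , f) =
  (sym (proj₁ A-split) , sym (proj₁ B-split)) , (sym (proj₂ A-split) , sym (proj₂ B-split))
  where
  A-split : length (take (nTrue S₁) A) ≡ nTrue S₁ × length (drop (nTrue S₁) A) ≡ nTrue S₂
  A-split = length-take-drop A (trans (sym (nTrue-++ S₁ S₂)) e)
  B-split : length (take (nFalse S₁) B) ≡ nFalse S₁ × length (drop (nFalse S₁) B) ≡ nFalse S₂
  B-split = length-take-drop B (trans (sym (nFalse-++ S₁ S₂)) f)

merge-≈-++⁻ : ∀ {S₁ S₂ A₁ A₂ B₁ B₂ X Y} → Fits S₁ A₁ B₁ → Fits S₂ A₂ B₂ →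
  merge (S₁ ++ S₂) (A₁ ++ A₂) (B₁ ++ B₂) ≈ X ++ Y → length S₁ ≡ length X → Disjoint X Y →
  (Disjoint A₁ A₂ × Disjoint B₁ B₂) × merge S₂ A₂ B₂ ≈ Y
merge-≈-++⁻ {S₁} {S₂} {A₁} {A₂} {B₁} {B₂} {X} {Y} fits₁ fits₂ merge≈XY ∣S₁∣≡∣X∣ X∩Y≡∅ =
  ( (λ (a∈A₁ , a∈A₂) → M₁∩M₂≡∅ (∈-merge⁺ˡ S₁ A₁ B₁ fits₁ a∈A₁ , ∈-merge⁺ˡ S₂ A₂ B₂ fits₂ a∈A₂))
  , (λ (b∈B₁ , b∈B₂) → M₁∩M₂≡∅ (∈-merge⁺ʳ S₁ A₁ B₁ fits₁ b∈B₁ , ∈-merge⁺ʳ S₂ A₂ B₂ fits₂ b∈B₂)))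
  , ≈-++⁻ʳ ∣M₁∣≡∣X∣ M₁M₂≈XY
  where
  M₁M₂≈XY : merge S₁ A₁ B₁ ++ merge S₂ A₂ B₂ ≈ X ++ Y
  M₁M₂≈XY = subst (_≈ X ++ Y) (merge-++ S₁ fits₁) merge≈XY
  ∣M₁∣≡∣X∣ : length (merge S₁ A₁ B₁) ≡ length X
  ∣M₁∣≡∣X∣ = trans (merge-length S₁ A₁ B₁ fits₁) ∣S₁∣≡∣X∣
  M₁∩M₂≡∅ : Disjoint (merge S₁ A₁ B₁) (merge S₂ A₂ B₂)
  M₁∩M₂≡∅ = ≈-++-disjoint ∣M₁∣≡∣X∣ M₁M₂≈XY X∩Y≡∅

∈-subsetsOfSize⁺ : ∀ S {k N} → length S ≡ N → nTrue S ≡ k → S ∈ subsetsOfSize k N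
∈-subsetsOfSize⁺ []          {zero}  refl refl = here refl
∈-subsetsOfSize⁺ (true ∷ S)  {suc k} refl refl = ∈-++⁺ˡ (∈-map⁺ _ (∈-subsetsOfSize⁺ S refl refl))
∈-subsetsOfSize⁺ (false ∷ S) {zero}  refl e    = ∈-map⁺ _ (∈-subsetsOfSize⁺ S refl e)
∈-subsetsOfSize⁺ (false ∷ S) {suc k} refl e    =
  ∈-++⁺ʳ (map (true ∷_) (subsetsOfSize k (length S))) (∈-map⁺ _ (∈-subsetsOfSize⁺ S refl e))

∈-subsetsOfSize⁻ : ∀ k N {S} → S ∈ subsetsOfSize k N → length S ≡ N × nTrue S ≡ k
∈-subsetsOfSize⁻ zero    zero    (here refl) = refl , refl
∈-subsetsOfSize⁻ zero    (suc N) S∈ with ∈-map⁻ _ S∈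
... | S , S∈′ , refl = Product.map₁ (cong suc) (∈-subsetsOfSize⁻ zero N S∈′)
∈-subsetsOfSize⁻ (suc k) (suc N) S∈ with ∈-++⁻ (map (true ∷_) (subsetsOfSize k N)) S∈
... | inj₁ S∈ᵗ with ∈-map⁻ _ S∈ᵗ
...   | S , S∈′ , refl = Product.map (cong suc) (cong suc) (∈-subsetsOfSize⁻ k N S∈′)
∈-subsetsOfSize⁻ (suc k) (suc N) S∈ | inj₂ S∈ᶠ with ∈-map⁻ _ S∈ᶠ
...   | S , S∈′ , refl = Product.map₁ (cong suc) (∈-subsetsOfSize⁻ (suc k) N S∈′)

subsetsOfSize-unique : ∀ k N → Unique (subsetsOfSize k N)
subsetsOfSize-unique zero    zero    = [] ∷ []
subsetsOfSize-unique (suc k) zero    = []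
subsetsOfSize-unique zero    (suc N) = Unique.map⁺ ∷-injectiveʳ (subsetsOfSize-unique zero N)
subsetsOfSize-unique (suc k) (suc N) = Unique.++⁺
  (Unique.map⁺ ∷-injectiveʳ (subsetsOfSize-unique k N))
  (Unique.map⁺ ∷-injectiveʳ (subsetsOfSize-unique (suc k) N))
  λ (S∈ᵗ , S∈ᶠ) → case ∈-map⁻ _ S∈ᵗ , ∈-map⁻ _ S∈ᶠ of λ where
    ((_ , _ , refl) , (_ , _ , ()))

fits⇒∈-subsetsOfSize : ∀ {S} A B → Fits S A B → S ∈ subsetsOfSize (length A) (length A + length B)
fits⇒∈-subsetsOfSize {S} A B (e , f) = ∈-subsetsOfSize⁺ S (trans (length≡nTrue+nFalse S) (cong₂ _+_ e f)) e

∈-subsetsOfSize⇒fits : ∀ {S} A B → S ∈ subsetsOfSize (length A) (length A + length B) → Fits S A B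
∈-subsetsOfSize⇒fits {S} A B S∈ with ∈-subsetsOfSize⁻ (length A) (length A + length B) S∈
... | ∣S∣≡ , e = e , +-cancelˡ-≡ (length A) _ _ (begin
  length A + nFalse S   ≡⟨ cong (_+ nFalse S) e ⟨
  nTrue S + nFalse S    ≡⟨ length≡nTrue+nFalse S ⟨
  length S              ≡⟨ ∣S∣≡ ⟩
  length A + length B   ∎)
  where open ≡-Reasoning

-- Shuffles of atomic factorisations

-- For each shuffle of a and b, in the order of shuffles a b, the positions taken by the letters of a.
blockShuffles : List Part → List Part → List (List Bool)
blockShuffles []      []      = [] ∷ []
blockShuffles []      (y ∷ b) = map (falses (length y) ++_) (blockShuffles [] b)
blockShuffles (x ∷ a) []      = map (trues (length x) ++_) (blockShuffles a [])
blockShuffles (x ∷ a) (y ∷ b) =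
  map (trues (length x) ++_) (blockShuffles a (y ∷ b)) ++ map (falses (length y) ++_) (blockShuffles (x ∷ a) b)

record Realises (a b u : List Part) (S : List Bool) : Set where
  constructor realises
  field
    fits     : Fits S (concatW a) (concatW b)
    u≈merge : concatW u ≈ merge S (concatW a) (concatW b)

module _ {a b u S} (r : Realises a b u S) where
  open Realises r

  realises-∷ˡ : ∀ x → Realises (x ∷ a) b (x ∷ u) (trues (length x) ++ S)
  realises-∷ˡ x = realises fits′ $ subst (concatW (x ∷ u) ≈_) (sym merge≡)
    (++-≈ (≈-sym (map-≈ tagˡ-injective (map tagˡ x)))
          (≈-trans (map-≈ tagʳ-injective (concatW u))
                   (≈-trans u≈merge (merge-≈ S fits (≈-sym (map-≈ tagʳ-injective (concatW a))) ≈-refl)))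
          (tags-disjoint x (concatW u))
          (merge-disjointˡ S fitsʳ (tags-disjoint x (concatW a))))
    where
    fitsʳ : Fits S (map tagʳ (concatW a)) (concatW b)
    fitsʳ = trans (proj₁ fits) (sym (length-map tagʳ (concatW a))) , proj₂ fits
    fits′ : Fits (trues (length x) ++ S) (concatW (x ∷ a)) (concatW b)
    fits′ = fits-trues-++ (map tagˡ x) {B = concatW b} (length-map tagˡ x) fitsʳ
    merge≡ : merge (trues (length x) ++ S) (concatW (x ∷ a)) (concatW b)
           ≡ map tagˡ (map tagˡ x) ++ merge S (map tagʳ (concatW a)) (concatW b)
    merge≡ = merge-trues-++ (map tagˡ x) (length-map tagˡ x) S _ _

  realises-∷ʳ : ∀ y → Realises a (y ∷ b) (y ∷ u) (falses (length y) ++ S)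
  realises-∷ʳ y = realises fits′ $ subst (concatW (y ∷ u) ≈_) (sym merge≡)
    (++-≈ (≈-sym (map-≈ tagʳ-injective (map tagˡ y)))
          (≈-trans (map-≈ tagʳ-injective (concatW u))
                   (≈-trans u≈merge (merge-≈ S fits ≈-refl (≈-sym (map-≈ tagʳ-injective (concatW b))))))
          (tags-disjoint y (concatW u))
          (merge-disjointʳ S fitsʳ (tags-disjoint y (concatW b))))
    where
    fitsʳ : Fits S (concatW a) (map tagʳ (concatW b))
    fitsʳ = proj₁ fits , trans (proj₂ fits) (sym (length-map tagʳ (concatW b)))
    fits′ : Fits (falses (length y) ++ S) (concatW a) (concatW (y ∷ b))
    fits′ = fits-falses-++ (map tagˡ y) {A = concatW a} (length-map tagˡ y) fitsʳ
    merge≡ : merge (falses (length y) ++ S) (concatW a) (concatW (y ∷ b))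
           ≡ map tagʳ (map tagˡ y) ++ merge S (concatW a) (map tagʳ (concatW b))
    merge≡ = merge-falses-++ (map tagˡ y) (length-map tagˡ y) S _ _

realises-map-∷ˡ : ∀ x {a b us Ss} → Pointwise (Realises a b) us Ss →
  Pointwise (Realises (x ∷ a) b) (map (x ∷_) us) (map (trues (length x) ++_) Ss)
realises-map-∷ˡ x = Pointwise.map⁺ (x ∷_) (trues (length x) ++_) ∘ Pointwise.map (λ r → realises-∷ˡ r x)

realises-map-∷ʳ : ∀ y {a b us Ss} → Pointwise (Realises a b) us Ss →
  Pointwise (Realises a (y ∷ b)) (map (y ∷_) us) (map (falses (length y) ++_) Ss)
realises-map-∷ʳ y = Pointwise.map⁺ (y ∷_) (falses (length y) ++_) ∘ Pointwise.map (λ r → realises-∷ʳ r y)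

blockShuffles-realise : ∀ a b → Pointwise (Realises a b) (shuffles a b) (blockShuffles a b)
blockShuffles-realise []           []      = realises (refl , refl) ≈-refl ∷ []
blockShuffles-realise []           (y ∷ b) = realises-map-∷ʳ y (blockShuffles-realise [] b)
-- a is split so that shuffles a [] reduces to a ∷ [].
blockShuffles-realise (x ∷ [])     []      = realises-map-∷ˡ x (blockShuffles-realise [] [])
blockShuffles-realise (x ∷ x′ ∷ a) []      = realises-map-∷ˡ x (blockShuffles-realise (x′ ∷ a) [])
blockShuffles-realise (x ∷ a)      (y ∷ b) = Pointwise.++⁺
  (realises-map-∷ˡ x (blockShuffles-realise a (y ∷ b)))
  (realises-map-∷ʳ y (blockShuffles-realise (x ∷ a) b))

∈-blockShuffles-∷ˡ : ∀ x {a b S} → S ∈ blockShuffles a b → trues (length x) ++ S ∈ blockShuffles (x ∷ a) b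
∈-blockShuffles-∷ˡ x {b = []}    S∈ = ∈-map⁺ _ S∈
∈-blockShuffles-∷ˡ x {b = _ ∷ _} S∈ = ∈-++⁺ˡ (∈-map⁺ _ S∈)

∈-blockShuffles-∷ʳ : ∀ y {a b S} → S ∈ blockShuffles a b → falses (length y) ++ S ∈ blockShuffles a (y ∷ b)
∈-blockShuffles-∷ʳ y {a = []}    S∈ = ∈-map⁺ _ S∈
∈-blockShuffles-∷ʳ y {a = x ∷ a} {b} S∈ = ∈-++⁺ʳ (map (trues (length x) ++_) (blockShuffles a (y ∷ b))) (∈-map⁺ _ S∈)

blockShuffles-unique : ∀ {a b} → All NonEmpty a → All NonEmpty b → Unique (blockShuffles a b)
blockShuffles-unique []                []                = [] ∷ []
blockShuffles-unique []                (_ ∷ b-nonempty) =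
  Unique.map⁺ (++-cancelˡ _ _ _) (blockShuffles-unique [] b-nonempty)
blockShuffles-unique (_ ∷ a-nonempty) []                =
  Unique.map⁺ (++-cancelˡ _ _ _) (blockShuffles-unique a-nonempty [])
blockShuffles-unique {x ∷ a} {y ∷ b} (x-nonempty ∷ a-nonempty) (y-nonempty ∷ b-nonempty) = Unique.++⁺
  (Unique.map⁺ (++-cancelˡ _ _ _) (blockShuffles-unique a-nonempty (y-nonempty ∷ b-nonempty)))
  (Unique.map⁺ (++-cancelˡ _ _ _) (blockShuffles-unique (x-nonempty ∷ a-nonempty) b-nonempty))
  λ (S∈ˡ , S∈ʳ) → case ∈-map⁻ _ S∈ˡ , ∈-map⁻ _ S∈ʳ of λ where
    ((_ , _ , refl) , (_ , _ , eq)) → trues≢falses x-nonempty y-nonempty eq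
  where
  trues≢falses : ∀ {m n} {s t : List Bool} → 0 < m → 0 < n → ¬ trues m ++ s ≡ falses n ++ t
  trues≢falses {suc _} {suc _} _ _ ()

blockShuffles-fit : ∀ a b {S} → S ∈ blockShuffles a b → Fits S (concatW a) (concatW b)
blockShuffles-fit a b S∈ = Realises.fits (proj₂ (∈-Pointwiseʳ (blockShuffles-realise a b) S∈))

shuffleCoeff≡countᵇ-blockShuffles : ∀ {A B} a b P → A ≈ concatW a → B ≈ concatW b →
  shuffleCoeff a b P ≡ countᵇ (λ S → merge S A B ≈ᵇ P) (blockShuffles a b)
shuffleCoeff≡countᵇ-blockShuffles a b P A≈ B≈ = countᵇ-Pointwise
  (λ {_} {S} (realises fits u≈merge) → ≈ᵇ-congˡ P (≈-trans u≈merge (merge-≈ S fits (≈-sym A≈) (≈-sym B≈))))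
  (blockShuffles-realise a b)

realises-≈ : ∀ {A B a b d S} → A ≈ concatW a → B ≈ concatW b → Fits S A B → merge S A B ≈ concatW d →
  Realises a b d S
realises-≈ {S = S} A≈ B≈ fits merge≈ = realises (fits-≈ S fits A≈ B≈) (≈-trans (≈-sym merge≈) (merge-≈ S fits A≈ B≈))

-- Factorisations of a merge

record FactorSplit (a b d : List Part) (S : List Bool) : Set where
  field
    S₁ S₂       : List Bool
    S≡          : S ≡ S₁ ++ S₂
    S₁-nonempty : 0 < length S₁
    boundaryᵃ   : FactorBoundary a (nTrue S₁)
    boundaryᵇ   : FactorBoundary b (nFalse S₁)
    rest        : Realises (suffix boundaryᵃ) (suffix boundaryᵇ) d S₂

splitFirstFactor : ∀ {a b d₁ d S} → All Atomic a → All Atomic b → 0 < length d₁ →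
  Realises a b (d₁ ∷ d) S → FactorSplit a b d S
splitFirstFactor {a} {b} {d₁} {d} {S} a-atomic b-atomic d₁-nonempty (realises fits d≈merge) = record
  { S₁          = S₁
  ; S₂          = S₂
  ; S≡          = S≡
  ; S₁-nonempty = subst (0 <_) (sym ∣S₁∣≡j) d₁-nonempty
  ; boundaryᵃ   = boundaryᵃ
  ; boundaryᵇ   = boundaryᵇ
  ; rest        = realises-≈ (drop-≈-suffix boundaryᵃ) (drop-≈-suffix boundaryᵇ) fits₂
                             (≈-trans (proj₂ split) (map-≈ tagʳ-injective (concatW d)))
  }
  where
  Ca Cb : Part
  Ca = concatW a
  Cb = concatW b
  j : ℕ
  j = length d₁
  S₁ S₂ : List Bool
  S₁ = take j S
  S₂ = drop j S
  i k : ℕ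
  i = nTrue S₁
  k = nFalse S₁
  S≡ : S ≡ S₁ ++ S₂
  S≡ = sym (take++drop≡id j S)
  ∣S∣≡ : length S ≡ j + length (map tagʳ (concatW d))
  ∣S∣≡ = trans (sym (merge-length S Ca Cb fits))
               (trans (sym (length≡ d≈merge)) (trans (length-++ (map tagˡ d₁)) (cong (_+ _) (length-map tagˡ d₁))))
  ∣S₁∣≡j : length S₁ ≡ j
  ∣S₁∣≡j = length-take-≤ S (subst (j ≤_) (sym ∣S∣≡) (m≤m+n _ _))
  fits₁ : Fits S₁ (take i Ca) (take k Cb)
  fits₁ = proj₁ (fits-++⁻ S₁ (subst (λ T → Fits T Ca Cb) S≡ fits))
  fits₂ : Fits S₂ (drop i Ca) (drop k Cb)
  fits₂ = proj₂ (fits-++⁻ S₁ (subst (λ T → Fits T Ca Cb) S≡ fits))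
  merge≡ : merge S Ca Cb ≡ merge (S₁ ++ S₂) (take i Ca ++ drop i Ca) (take k Cb ++ drop k Cb)
  merge≡ = trans (cong (λ T → merge T Ca Cb) S≡)
                 (sym (cong₂ (merge (S₁ ++ S₂)) (take++drop≡id i Ca) (take++drop≡id k Cb)))
  split : (Disjoint (take i Ca) (drop i Ca) × Disjoint (take k Cb) (drop k Cb)) ×
          merge S₂ (drop i Ca) (drop k Cb) ≈ map tagʳ (concatW d)
  split = merge-≈-++⁻ fits₁ fits₂ (subst (_≈ concatW (d₁ ∷ d)) merge≡ (≈-sym d≈merge))
            (trans ∣S₁∣≡j (sym (length-map tagˡ d₁))) (tags-disjoint d₁ (concatW d))
  ≤-size : ∀ {n} w → n ≡ length (take n (concatW w)) → n ≤ size w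
  ≤-size {n} w n≡ = subst₂ _≤_ (sym (trans n≡ (length-take n (concatW w)))) (length-concatW w) (m⊓n≤n n _)
  boundaryᵃ : FactorBoundary a i
  boundaryᵃ = factorBoundary a i a-atomic (≤-size a (proj₁ fits₁)) (proj₁ (proj₁ split))
  boundaryᵇ : FactorBoundary b k
  boundaryᵇ = factorBoundary b k b-atomic (≤-size b (proj₂ fits₁)) (proj₂ (proj₁ split))

module _ {a b d S} (sp : FactorSplit a b d S) where
  open FactorSplit sp

  prefixes suffixes : ℕ
  prefixes = length (prefix boundaryᵃ) + length (prefix boundaryᵇ)
  suffixes = length (suffix boundaryᵃ) + length (suffix boundaryᵇ)

  length≡prefixes+suffixes : length a + length b ≡ prefixes + suffixes
  length≡prefixes+suffixes = trans (cong₂ _+_ (lengths boundaryᵃ) (lengths boundaryᵇ))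
    (interchange (length (prefix boundaryᵃ)) (length (suffix boundaryᵃ))
                 (length (prefix boundaryᵇ)) (length (suffix boundaryᵇ)))
    where
    lengths : ∀ {w i} (fb : FactorBoundary w i) → length w ≡ length (prefix fb) + length (suffix fb)
    lengths fb = trans (cong length (a≡ fb)) (length-++ (prefix fb))

  0<prefixes : 0 < prefixes
  0<prefixes = nonempty (prefix boundaryᵃ) (prefix boundaryᵇ)
    (subst (0 <_) (trans (length≡nTrue+nFalse S₁)
                         (cong₂ _+_ (sym (size-prefix boundaryᵃ)) (sym (size-prefix boundaryᵇ))))
           S₁-nonempty)
    where
    nonempty : ∀ a₁ b₁ → 0 < size a₁ + size b₁ → 0 < length a₁ + length b₁
    nonempty (_ ∷ _) _       _ = s≤s z≤n
    nonempty []      (_ ∷ _) _ = s≤s z≤n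

factorisation-length-≤ : ∀ {a b d S} → All Atomic a → All Atomic b → All NonEmpty d → Realises a b d S →
  length d ≤ length a + length b
factorisation-length-≤ _ _ [] _ = z≤n
factorisation-length-≤ {a} {b} {d₁ ∷ d} {S} a-atomic b-atomic (d₁-nonempty ∷ d-nonempty) r = begin
  1 + length d         ≤⟨ +-mono-≤ (0<prefixes sp) (factorisation-length-≤ (All-suffix a-atomic boundaryᵃ)
                                                      (All-suffix b-atomic boundaryᵇ) d-nonempty rest) ⟩
  prefixes sp + suffixes sp ≡⟨ length≡prefixes+suffixes sp ⟨
  length a + length b  ∎
  where
  open ≤-Reasoning
  sp : FactorSplit a b d S
  sp = splitFirstFactor a-atomic b-atomic d₁-nonempty r
  open FactorSplit sp

∈-blockShuffles-++ : ∀ a₁ b₁ {a₂ b₂ S₁ S₂} → length a₁ + length b₁ ≡ 1 → nTrue S₁ ≡ size a₁ → nFalse S₁ ≡ size b₁ →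
  S₂ ∈ blockShuffles a₂ b₂ → S₁ ++ S₂ ∈ blockShuffles (a₁ ++ a₂) (b₁ ++ b₂)
∈-blockShuffles-++ (x ∷ []) [] {a₂} {b₂} {S₁} {S₂} refl t f S₂∈ =
  subst (λ T → T ++ S₂ ∈ _) (sym S₁≡) (∈-blockShuffles-∷ˡ x {a₂} {b₂} S₂∈)
  where
  S₁≡ : S₁ ≡ trues (length x)
  S₁≡ = trans (nFalse≡0⇒trues S₁ f) (cong trues (trans t (+-identityʳ _)))
∈-blockShuffles-++ [] (y ∷ []) {a₂} {b₂} {S₁} {S₂} refl t f S₂∈ =
  subst (λ T → T ++ S₂ ∈ _) (sym S₁≡) (∈-blockShuffles-∷ʳ y {a₂} {b₂} S₂∈)
  where
  S₁≡ : S₁ ≡ falses (length y)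
  S₁≡ = trans (nTrue≡0⇒falses S₁ t) (cong falses (trans f (+-identityʳ _)))

maximal-factorisation⇒∈-blockShuffles : ∀ {a b d S} → All Atomic a → All Atomic b → All NonEmpty d →
  Realises a b d S → length a + length b ≤ length d → S ∈ blockShuffles a b
maximal-factorisation⇒∈-blockShuffles {[]} {[]} {[]} {[]} _ _ [] _ _ = here refl
maximal-factorisation⇒∈-blockShuffles {[]} {[]} {[]} {true ∷ _}  _ _ [] (realises (() , _) _) _
maximal-factorisation⇒∈-blockShuffles {[]} {[]} {[]} {false ∷ _} _ _ [] (realises (_ , ()) _) _
maximal-factorisation⇒∈-blockShuffles {a} {b} {d₁ ∷ d} {S} a-atomic b-atomic (d₁-nonempty ∷ d-nonempty) r maximal =
  subst (_∈ _) (sym S≡) $ subst₂ (λ a′ b′ → S₁ ++ S₂ ∈ blockShuffles a′ b′) (sym (a≡ boundaryᵃ)) (sym (a≡ boundaryᵇ))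
    (∈-blockShuffles-++ (prefix boundaryᵃ) (prefix boundaryᵇ) (proj₁ tight) (sym (size-prefix boundaryᵃ))
       (sym (size-prefix boundaryᵇ))
       (maximal-factorisation⇒∈-blockShuffles a₂-atomic b₂-atomic d-nonempty rest (proj₂ tight)))
  where
  sp : FactorSplit a b d S
  sp = splitFirstFactor a-atomic b-atomic d₁-nonempty r
  open FactorSplit sp
  a₂-atomic : All Atomic (suffix boundaryᵃ)
  a₂-atomic = All-suffix a-atomic boundaryᵃ
  b₂-atomic : All Atomic (suffix boundaryᵇ)
  b₂-atomic = All-suffix b-atomic boundaryᵇ
  tight : prefixes sp ≡ 1 × suffixes sp ≤ length d
  tight = tight-sum (0<prefixes sp) (factorisation-length-≤ a₂-atomic b₂-atomic d-nonempty rest)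
                    (subst (_≤ suc (length d)) (length≡prefixes+suffixes sp) maximal)

mainTheorem9 : (A B : Part) (a b : List Part) →
    IsFactorisation A a → IsFactorisation B b →
    Σ (Part → ℕ) λ c →
      (∀ D d → IsFactorisation D d → length a + length b ≤ length d → c D ≡ 0) ×
      (∀ P → productCoeff A B P ≡ shuffleCoeff a b P + c P)
mainTheorem9 A B a b (a-atomic , a≈ᵇA) (b-atomic , b≈ᵇB) = c , c-vanishes , product≡shuffle+c
  where
  A≈ : A ≈ concatW a
  A≈ = ≈-sym (≈ᵇ⇒≈ {Y = A} a≈ᵇA)
  B≈ : B ≈ concatW b
  B≈ = ≈-sym (≈ᵇ⇒≈ {Y = B} b≈ᵇB)
  _≟ˢ_ : DecidableEquality (List Bool)
  _≟ˢ_ = ≡-dec _≟_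
  blocks subsets : List (List Bool)
  blocks = blockShuffles a b
  subsets = subsetsOfSize (length A) (length A + length B)
  mergesTo : Part → List Bool → Bool
  mergesTo P S = merge S A B ≈ᵇ P
  c : Part → ℕ
  c P = countᵇOutside _≟ˢ_ (mergesTo P) blocks subsets
  blocks⊆subsets : blocks ⊆ subsets
  blocks⊆subsets {S} S∈ = fits⇒∈-subsetsOfSize A B (fits-≈ S (blockShuffles-fit a b S∈) (≈-sym A≈) (≈-sym B≈))
  product≡shuffle+c : ∀ P → productCoeff A B P ≡ shuffleCoeff a b P + c P
  product≡shuffle+c P = trans
    (countᵇ-⊆ _≟ˢ_ (mergesTo P) (blockShuffles-unique (All.map proj₁ a-atomic) (All.map proj₁ b-atomic))
              (subsetsOfSize-unique (length A) (length A + length B)) blocks⊆subsets)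
    (cong (_+ c P) (sym (shuffleCoeff≡countᵇ-blockShuffles a b P A≈ B≈)))
  c-vanishes : ∀ D d → IsFactorisation D d → length a + length b ≤ length d → c D ≡ 0
  c-vanishes D d (d-atomic , d≈ᵇD) maximal = countᵇOutside≡0 _≟ˢ_ (mergesTo D) {blocks} {subsets} λ S∈ merges →
    maximal-factorisation⇒∈-blockShuffles a-atomic b-atomic (All.map proj₁ d-atomic)
      (realises-≈ A≈ B≈ (∈-subsetsOfSize⇒fits A B S∈) (≈-trans (≈ᵇ⇒≈ {Y = D} merges) (≈-sym (≈ᵇ⇒≈ {Y = D} d≈ᵇD))))
      maximal
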